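{- Let $m>6$ and let $G=\Theta(s_1,s_2,\ldots,s_m)$ be a generalized theta graph with $s_{i+1}=s_i+1$ for all $i\in\{1,\ldots,m-1\}$. Then $\beta(G)=m-3$.
   Context: Graphs are simple, connected, finite. A set $W\subseteq V(G)$ is resolving if for any distinct $u,v$ there is $w\in W$ with $d(u,w)\ne d(v,w)$; $\beta(G)$ is the minimum size of a resolving set. For positive integers $s_1\le\cdots\le s_m$, $\Theta(s_1,\ldots,s_m)$ consists of two vertices $c_1,c_2$ (centers) joined by $m$ internally disjoint paths, the $i$-th having $s_i$ internal vertices (length $s_i+1$). -}

module Defs where

open import Data.Nat using (ℕ; zero; suc; _≤_)
open import Data.Fin using (Fin; toℕ)
open import Data.List using (List; length)
open import Data.List.Membership.Propositional using (_∈_)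
open import Data.List.Relation.Unary.Unique.Propositional using (Unique)
open import Data.Product using (Σ; ∃; _×_; _,_)
open import Relation.Binary.PropositionalEquality using (_≡_; _≢_)
open import Data.Sum using (_⊎_)
open import Data.Empty using (⊥)

record Graph : Set₁ where
  field
    V   : Set
    Adj : V → V → Set
open Graph public

data Walk (G : Graph) : V G → V G → ℕ → Set where
  here  : ∀ {u} → Walk G u u 0
  step  : ∀ {u w v k} → Adj G u w → Walk G w v k → Walk G u v (suc k)

Dist : (G : Graph) → V G → V G → ℕ → Set
Dist G u v k = Walk G u v k × (∀ j → Walk G u v j → k ≤ j)

Resolving : (G : Graph) → List (V G) → Set
Resolving G W = ∀ (u v : V G) → u ≢ v →
  Σ (V G) λ w → w ∈ W × Σ ℕ λ du → Σ ℕ λ dv →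
    Dist G u w du × Dist G v w dv × du ≢ dv

MetricDimension : Graph → ℕ → Set
MetricDimension G k =
  (Σ (List (V G)) λ W → Unique W × length W ≡ k × Resolving G W)
  × (∀ (W : List (V G)) → Unique W → Resolving G W → k ≤ length W)

-- Vertices of Θ(s_1,…,s_m): the two centers and the internal vertices
-- inner i j, j-th internal vertex (0-based) of the i-th path.
data ThetaV (m : ℕ) (s : Fin m → ℕ) : Set where
  c₁ : ThetaV m s
  c₂ : ThetaV m s
  inner : (i : Fin m) → Fin (s i) → ThetaV m s

-- Directed adjacency along paths: c₁ → inner i 0 → … → inner i (s i - 1) → c₂.
ThetaArc : (m : ℕ) (s : Fin m → ℕ) → ThetaV m s → ThetaV m s → Set
ThetaArc m s c₁ (inner i j) = toℕ j ≡ 0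
ThetaArc m s (inner i j) c₂ = suc (toℕ j) ≡ s i
ThetaArc m s (inner i j) (inner i' j') = (i ≡ i') × (suc (toℕ j) ≡ toℕ j')
ThetaArc m s _ _ = ⊥

Theta : (m : ℕ) → (Fin m → ℕ) → Graph
Theta m s = record
  { V   = ThetaV m s
  ; Adj = λ u v → ThetaArc m s u v ⊎ ThetaArc m s v u }

-- Number the paths 0, …, m − 1, so that path i has s₀ + i inner vertices and c₁, c₂ are at
-- distance D = s₀ + 1. Lower bound: the first vertices of two paths longer than D have equal
-- distances to every vertex outside these two paths (any walk out of a long path is best routed
-- through c₁), so a resolving set meets all but one of the m − 2 paths 2, …, m − 1.
-- Upper bound: on each path j ≥ 3 put a landmark about halfway along the cycle formed with path 0,
-- so that it is reached through c₁ from every vertex off path j (for j = 3, 4 mirror it, so that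
-- c₂ plays this role). Off path j its distance is then d(·, c₁) (resp. d(·, c₂)) plus a constant,
-- and on path j it is strictly smaller. Comparing two landmarks of the same kind shows that equal
-- readings put u and v on the same landmark paths; the landmarks of the other paths then give
-- d(u, c₁) = d(v, c₁) and d(u, c₂) = d(v, c₂), which determine a vertex on a common path, and
-- also among the centres and the vertices of the short paths 0, 1, 2.

module Submission where

open import Defs
open import Data.Nat using (ℕ; suc; _<_; _≤_; _∸_)
open import Data.Fin using (Fin; toℕ)
open import Relation.Binary.PropositionalEquality using (_≡_)

open import Data.Nat
open import Data.Nat.Properties
open import Data.Fin as F using (fromℕ<)
open import Data.Fin.Properties as FP using (toℕ-injective; toℕ-fromℕ<; toℕ<n; pigeonhole; ¬∀⟶∃¬; all?)
open import Data.Product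
open import Data.Sum
open import Data.Empty
open import Data.Bool using (Bool; true; false)
open import Data.List using (List; length; tabulate; lookup)
open import Data.List.Properties using (length-tabulate)
open import Data.List.Relation.Unary.Any as Any using (Any; any?)
open import Data.List.Relation.Unary.Any.Properties using (lookup-index)
open import Data.List.Membership.Propositional.Properties using (∈-tabulate⁺)
open import Data.List.Relation.Unary.Unique.Propositional.Properties using (tabulate⁺)
open import Relation.Nullary
open import Relation.Binary.Definitions using (tri<; tri≈; tri>)
open import Relation.Binary.PropositionalEquality
open import Function using (_∘_)
open import Data.Nat.Tactic.RingSolver using (solve-∀)

module _ {G : Graph} where

  _++ʷ_ : ∀ {u v w k l} → Walk G u v k → Walk G v w l → Walk G u w (k + l)
  here ++ʷ q = q
  step a p ++ʷ q = step a (p ++ʷ q)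

  map-Walk : (σ : V G → V G) → (∀ {x y} → Adj G x y → Adj G (σ x) (σ y)) →
             ∀ {x y k} → Walk G x y k → Walk G (σ x) (σ y) k
  map-Walk σ σ-adj here = here
  map-Walk σ σ-adj (step a p) = step (σ-adj a) (map-Walk σ σ-adj p)

  Dist-involution : (σ : V G → V G) → (∀ {x y} → Adj G x y → Adj G (σ x) (σ y)) →
                    (∀ x → σ (σ x) ≡ x) → ∀ {x y k} → Dist G x y k → Dist G (σ x) (σ y) k
  Dist-involution σ σ-adj σ∘σ {x} {y} (p , shortest) =
    map-Walk σ σ-adj p ,
    λ j q → shortest j (subst₂ (λ u v → Walk G u v j) (σ∘σ x) (σ∘σ y) (map-Walk σ σ-adj q))

  potential⇒Dist : (w : V G) (f : V G → ℕ) →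
                   (∀ {x y} → Adj G x y → f x ≤ suc (f y)) →
                   f w ≡ 0 → (∀ x → f x ≡ 0 → x ≡ w) →
                   (∀ x n → f x ≡ suc n → Σ (V G) λ y → Adj G x y × f y ≡ n) →
                   ∀ x → Dist G x w (f x)
  potential⇒Dist w f lip fw≡0 f≡0⇒w descent x = walk (f x) x refl , λ _ → lower
    where
    lower : ∀ {x k} → Walk G x w k → f x ≤ k
    lower here = ≤-reflexive fw≡0
    lower (step a p) = ≤-trans (lip a) (s≤s (lower p))

    walk : ∀ n x → f x ≡ n → Walk G x w n
    walk zero x e with f≡0⇒w x e
    ... | refl = here
    walk (suc n) x e with descent x n e
    ... | y , a , e′ = step a (walk n y e′)

  tabulate-Resolving : ∀ {n} (ℓ : Fin n → V G) (R : Fin n → V G → ℕ) →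
                       (∀ c v → Dist G v (ℓ c) (R c v)) →
                       (∀ u v → (∀ c → R c u ≡ R c v) → u ≡ v) →
                       Resolving G (tabulate ℓ)
  tabulate-Resolving {n} ℓ R dist determined u v u≢v
    with all? (λ c → R c u ≟ R c v)
  ... | yes same = ⊥-elim (u≢v (determined u v same))
  ... | no ¬same with ¬∀⟶∃¬ n _ (λ c → R c u ≟ R c v) ¬same
  ... | c , differ = ℓ c , ∈-tabulate⁺ c , R c u , R c v , dist c u , dist c v , differ

-- A pair of representatives whose regions both avoid W is not resolved by W, so at most one
-- of the n + 1 regions avoids W, and the others contain pairwise distinct elements of W.
module _ {G : Graph} {n : ℕ} (P : Fin (suc n) → V G → Set) (P? : ∀ c x → Dec (P c x))
         (disjoint : ∀ {c c′} x → P c x → P c′ x → c ≡ c′)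
         (t : Fin (suc n) → V G) (t∈P : ∀ c → P c (t c))
         (twins : ∀ {c c′ w du dv} → ¬ P c w → ¬ P c′ w →
                  Dist G (t c) w du → Dist G (t c′) w dv → du ≡ dv)
         (W : List (V G)) (resolving : Resolving G W) where

  private
    slot : ∀ {c} → Dec (Any (P c) W) → Fin (suc (length W))
    slot (yes hit) = F.suc (Any.index hit)
    slot (no _) = F.zero

    same-slot⇒≡ : ∀ {c c′} (h : Dec (Any (P c) W)) (h′ : Dec (Any (P c′) W)) → slot h ≡ slot h′ → c ≡ c′
    same-slot⇒≡ {c} {c′} (yes hit) (yes hit′) e =
      disjoint _ (lookup-index hit)
        (subst (λ i → P c′ (lookup W i)) (sym (FP.suc-injective e)) (lookup-index hit′))
    same-slot⇒≡ (yes _) (no _) ()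
    same-slot⇒≡ (no _) (yes _) ()
    same-slot⇒≡ {c} {c′} (no miss) (no miss′) _ with c F.≟ c′
    ... | yes c≡c′ = c≡c′
    ... | no c≢c′ with resolving (t c) (t c′) (λ e → c≢c′ (disjoint _ (subst (P c) e (t∈P c)) (t∈P c′)))
    ... | w , w∈W , du , dv , Du , Dv , du≢dv =
      ⊥-elim (du≢dv (twins (avoids miss) (avoids miss′) Du Dv))
      where
      avoids : ∀ {c} → ¬ Any (P c) W → ¬ P c w
      avoids miss p = miss (Any.map (λ { refl → p }) w∈W)

  twins⇒≤length : n ≤ length W
  twins⇒≤length with n ≤? length W
  ... | yes n≤∣W∣ = n≤∣W∣
  ... | no n≰∣W∣ with pigeonhole (s≤s (≰⇒> n≰∣W∣)) (λ c → slot (any? (P? c) W))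
  ... | c , c′ , c<c′ , e = ⊥-elim (FP.<⇒≢ c<c′ (same-slot⇒≡ (any? (P? c) W) (any? (P? c′) W) e))

Near : ℕ → ℕ → Set
Near x y = x ≤ suc y × y ≤ suc x

+-Near : ∀ r {x y} → Near x y → Near (r + x) (r + y)
+-Near r (x≤ , y≤) = ≤-trans (+-monoʳ-≤ r x≤) (≤-reflexive (+-suc r _)) ,
                      ≤-trans (+-monoʳ-≤ r y≤) (≤-reflexive (+-suc r _))

⊓-Near : ∀ x y → Near (x ⊓ suc y) (suc x ⊓ y)
⊓-Near x y = ≤-trans (⊓-monoˡ-≤ (suc y) (n≤1+n x)) (s≤s (⊓-monoˡ-≤ y (n≤1+n x))) ,
             ≤-trans (⊓-monoʳ-≤ (suc x) (n≤1+n y)) (s≤s (⊓-monoʳ-≤ x (n≤1+n y)))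

∣-∣-Near : ∀ x K → Near ∣ x - K ∣ ∣ suc x - K ∣
∣-∣-Near zero zero = z≤n , ≤-refl
∣-∣-Near zero (suc K) = ≤-refl , ≤-trans (n≤1+n K) (n≤1+n (suc K))
∣-∣-Near (suc x) zero = ≤-trans (n≤1+n (suc x)) (n≤1+n (suc (suc x))) , ≤-refl
∣-∣-Near (suc x) (suc K) = ∣-∣-Near x K

m<n⇒n∸m≡1+[n∸1+m] : ∀ {m n} → m < n → n ∸ m ≡ suc (n ∸ suc m)
m<n⇒n∸m≡1+[n∸1+m] = +-∸-assoc 1

halve : ∀ n → Σ ℕ λ K → Σ ℕ λ e → e ≤ 1 × n ≡ K + K + e
halve zero = 0 , 0 , z≤n , refl
halve (suc zero) = 0 , 1 , ≤-refl , refl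
halve (suc (suc n)) with halve n
... | K , e , e≤1 , refl = suc K , e , e≤1 , cong (λ x → suc x + e) (sym (+-suc K K))

-- For p ≤ L, cyc D L p is the distance from 0 to p on a cycle of length D + L.
cyc : ℕ → ℕ → ℕ → ℕ
cyc D L p = p ⊓ (D + (L ∸ p))

cyc-Near : ∀ D L {p} → p < L → Near (cyc D L p) (cyc D L (suc p))
cyc-Near D L {p} p<L = subst (λ q → Near (p ⊓ q) (cyc D L (suc p))) (sym D+[L∸p]) (⊓-Near p (D + (L ∸ suc p)))
  where
  D+[L∸p] : D + (L ∸ p) ≡ suc (D + (L ∸ suc p))
  D+[L∸p] = trans (cong (D +_) (m<n⇒n∸m≡1+[n∸1+m] p<L)) (+-suc D _)

cyc-descent : ∀ D L {p n} → suc p < L → cyc D L (suc p) ≡ suc n →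
              cyc D L p ≡ n ⊎ cyc D L (suc (suc p)) ≡ n
cyc-descent D L {p} {n} sp<L e with ≤-total (suc p) (D + (L ∸ suc p))
... | inj₁ sp≤ = inj₁ (trans (m≤n⇒m⊓n≡m p≤) (suc-injective (trans (sym (m≤n⇒m⊓n≡m sp≤)) e)))
  where
  p≤ : p ≤ D + (L ∸ p)
  p≤ = ≤-trans (n≤1+n p) (≤-trans sp≤ (+-monoʳ-≤ D (∸-monoʳ-≤ L (n≤1+n p))))
... | inj₂ sp≥ = inj₂ (trans (m≥n⇒m⊓n≡n ssp≥) D+q≡n)
  where
  D+q≡n : D + (L ∸ suc (suc p)) ≡ n
  D+q≡n = suc-injective (begin
    suc (D + (L ∸ suc (suc p))) ≡⟨ sym (+-suc D _) ⟩
    D + suc (L ∸ suc (suc p))   ≡⟨ cong (D +_) (sym (m<n⇒n∸m≡1+[n∸1+m] sp<L)) ⟩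
    D + (L ∸ suc p)             ≡⟨ sym (m≥n⇒m⊓n≡n sp≥) ⟩
    cyc D L (suc p)             ≡⟨ e ⟩
    suc n                       ∎)
    where open ≡-Reasoning
  ssp≥ : D + (L ∸ suc (suc p)) ≤ suc (suc p)
  ssp≥ = ≤-trans (≤-reflexive D+q≡n)
           (≤-trans (n≤1+n n) (≤-trans (≤-reflexive (sym e)) (≤-trans (m⊓n≤m (suc p) _) (n≤1+n (suc p)))))

cyc-end : ∀ {D L} → D ≤ L → cyc D L L ≡ D
cyc-end {D} {L} D≤L =
  trans (cong (λ q → L ⊓ (D + q)) (n∸n≡0 L)) (trans (cong (L ⊓_) (+-identityʳ D)) (m≥n⇒m⊓n≡n D≤L))

cyc-short : ∀ {D L p} → p < L → p ≤ suc D → cyc D L p ≡ p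
cyc-short {D} {L} {p} p<L p≤1+D =
  m≤n⇒m⊓n≡m (≤-trans p≤1+D (≤-trans (≤-reflexive (+-comm 1 D)) (+-monoʳ-≤ D (m<n⇒0<n∸m p<L))))

private
  ⊓-unwrapped : ∀ D {P Q} → D + Q ≤ P → Q ⊓ (D + P) ≡ Q
  ⊓-unwrapped D {P} {Q} D+Q≤P = m≤n⇒m⊓n≡m (≤-trans (m≤n+m Q D) (≤-trans D+Q≤P (m≤n+m P D)))

  wrapped-on-one-side : ∀ {D P Q P′ Q′} → 1 ≤ D → P + Q ≡ P′ + Q′ → P ≡ D + Q′ →
                        Q ⊓ (D + P) ≡ Q′ → P ≡ P′
  wrapped-on-one-side {D} {P} {Q} {P′} {Q′} D≥1 sum P≡D+Q′ e with ⊓-sel Q (D + P)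
  ... | inj₁ ⊓≡Q = +-cancelʳ-≡ Q P P′ (trans sum (cong (P′ +_) (trans (sym e) ⊓≡Q)))
  ... | inj₂ ⊓≡D+P = ⊥-elim (<-irrefl P≡D+[D+P] (≤-trans (m<n+m P D≥1) (m≤n+m (D + P) D)))
    where
    P≡D+[D+P] : P ≡ D + (D + P)
    P≡D+[D+P] = trans P≡D+Q′ (cong (D +_) (trans (sym e) ⊓≡D+P))

-- Points of an arc of a cycle are determined by their distances to both ends of the arc.
⊓-pair-injective : ∀ {D P Q P′ Q′} → 1 ≤ D → P + Q ≡ P′ + Q′ →
                   P ⊓ (D + Q) ≡ P′ ⊓ (D + Q′) → Q ⊓ (D + P) ≡ Q′ ⊓ (D + P′) → P ≡ P′
⊓-pair-injective {D} {P} {Q} {P′} {Q′} D≥1 sum e₁ e₂ with ⊓-sel P (D + Q) | ⊓-sel P′ (D + Q′)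
... | inj₁ x₁ | inj₁ x₂ = trans (sym x₁) (trans e₁ x₂)
... | inj₂ y₁ | inj₂ y₂ = +-cancelʳ-≡ Q P P′ (trans sum (cong (P′ +_) (sym Q≡Q′)))
  where
  Q≡Q′ : Q ≡ Q′
  Q≡Q′ = +-cancelˡ-≡ D Q Q′ (trans (sym y₁) (trans e₁ y₂))
... | inj₁ x₁ | inj₂ y₂ = wrapped-on-one-side D≥1 sum (trans (sym x₁) (trans e₁ y₂))
                            (trans e₂ (⊓-unwrapped D (m⊓n≡n⇒n≤m y₂)))
... | inj₂ y₁ | inj₁ x₂ = sym (wrapped-on-one-side D≥1 (sym sum) (trans (sym x₂) (trans (sym e₁) y₁))
                                 (trans (sym e₂) (⊓-unwrapped D (m⊓n≡n⇒n≤m y₁))))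

∣-∣-toward-up : ∀ J K {n} → J < K → ∣ J - K ∣ ≡ suc n → ∣ suc J - K ∣ ≡ n
∣-∣-toward-up zero (suc K) _ e = suc-injective e
∣-∣-toward-up (suc J) (suc K) (s≤s J<K) e = ∣-∣-toward-up J K J<K e

∣-∣-toward-down : ∀ J K {n} → K ≤ J → ∣ suc J - K ∣ ≡ suc n → ∣ J - K ∣ ≡ n
∣-∣-toward-down J zero _ e = trans (∣-∣-identityʳ J) (suc-injective e)
∣-∣-toward-down (suc J) (suc K) (s≤s K≤J) e = ∣-∣-toward-down J K K≤J e

last-index : ∀ {n} → 0 < n → Σ (Fin n) λ x → suc (toℕ x) ≡ n
last-index {suc n} _ = F.fromℕ n , cong suc (FP.toℕ-fromℕ n)

index-above : ∀ {n} (x : Fin n) → suc (toℕ x) < n → Σ (Fin n) λ y → toℕ y ≡ suc (toℕ x)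
index-above x sx<n = fromℕ< sx<n , toℕ-fromℕ< sx<n

index-below : ∀ {n} (x : Fin n) → 0 < toℕ x → Σ (Fin n) λ y → suc (toℕ y) ≡ toℕ x
index-below (F.suc x) _ = F.inject₁ x , cong suc (FP.toℕ-inject₁ x)

opposite-first : ∀ {n} (x : Fin n) → toℕ x ≡ 0 → suc (toℕ (F.opposite x)) ≡ n
opposite-first {suc n} x e = cong suc (trans (FP.opposite-prop x) (cong (n ∸_) e))

opposite-last : ∀ {n} (x : Fin n) → suc (toℕ x) ≡ n → toℕ (F.opposite x) ≡ 0
opposite-last {n} x e = trans (FP.opposite-prop x) (trans (cong (n ∸_) e) (n∸n≡0 n))

opposite-step : ∀ {n} (x y : Fin n) → suc (toℕ x) ≡ toℕ y → suc (toℕ (F.opposite y)) ≡ toℕ (F.opposite x)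
opposite-step {n} x y e = begin
  suc (toℕ (F.opposite y))   ≡⟨ cong suc (FP.opposite-prop y) ⟩
  suc (n ∸ suc (toℕ y))      ≡⟨ sym (m<n⇒n∸m≡1+[n∸1+m] (toℕ<n y)) ⟩
  n ∸ toℕ y                  ≡⟨ cong (n ∸_) (sym e) ⟩
  n ∸ suc (toℕ x)            ≡⟨ sym (FP.opposite-prop x) ⟩
  toℕ (F.opposite x)         ∎
  where open ≡-Reasoning

module ThetaGeometry (m : ℕ) (s : Fin m → ℕ) (ι : Fin m)
                     (ι-shortest : ∀ i → s ι ≤ s i) (ι-nonempty : 1 ≤ s ι) where

  G : Graph
  G = Theta m s

  D : ℕ
  D = suc (s ι)

  D≤1+s : ∀ i → D ≤ suc (s i)
  D≤1+s i = s≤s (ι-shortest i)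

  OnPath : Fin m → ThetaV m s → Set
  OnPath i (inner i′ _) = i′ ≡ i
  OnPath i _ = ⊥

  OnPath? : ∀ i x → Dec (OnPath i x)
  OnPath? i c₁ = no λ ()
  OnPath? i c₂ = no λ ()
  OnPath? i (inner i′ _) = i′ F.≟ i

  OnPath-unique : ∀ {i i′} x → OnPath i x → OnPath i′ x → i ≡ i′
  OnPath-unique (inner _ _) refl refl = refl

  σ : ThetaV m s → ThetaV m s
  σ c₁ = c₂
  σ c₂ = c₁
  σ (inner i x) = inner i (F.opposite x)

  σ-involutive : ∀ x → σ (σ x) ≡ x
  σ-involutive c₁ = refl
  σ-involutive c₂ = refl
  σ-involutive (inner i x) = cong (inner i) (FP.opposite-involutive x)

  σ-Arc : ∀ {x y} → ThetaArc m s x y → ThetaArc m s (σ y) (σ x)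
  σ-Arc {c₁} {inner i x} e = opposite-first x e
  σ-Arc {inner i x} {c₂} e = opposite-last x e
  σ-Arc {inner i x} {inner .i y} (refl , e) = refl , opposite-step x y e

  σ-Adj : ∀ {x y} → Adj G x y → Adj G (σ x) (σ y)
  σ-Adj (inj₁ a) = inj₂ (σ-Arc a)
  σ-Adj (inj₂ a) = inj₁ (σ-Arc a)

  mirror : Bool → ThetaV m s → ThetaV m s
  mirror false x = x
  mirror true x = σ x

  mirror-involutive : ∀ b x → mirror b (mirror b x) ≡ x
  mirror-involutive false x = refl
  mirror-involutive true x = σ-involutive x

  mirror-Adj : ∀ b {x y} → Adj G x y → Adj G (mirror b x) (mirror b y)
  mirror-Adj false a = a
  mirror-Adj true a = σ-Adj a

  mirror-OnPath : ∀ b {i} x → OnPath i (mirror b x) → OnPath i x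
  mirror-OnPath false x on = on
  mirror-OnPath true (inner _ _) on = on

  -- Paths i and ι form a cycle of length D + suc (s i); on path i, d₁ measures from c₁ along it.
  cycᵢ : Fin m → ℕ → ℕ
  cycᵢ i = cyc D (suc (s i))

  d₁ : ThetaV m s → ℕ
  d₁ c₁ = 0
  d₁ c₂ = D
  d₁ (inner i x) = cycᵢ i (suc (toℕ x))

  d₂ : ThetaV m s → ℕ
  d₂ x = d₁ (σ x)

  d₁-Near : ∀ {x y} → ThetaArc m s x y → Near (d₁ x) (d₁ y)
  d₁-Near {c₁} {inner i x} e =
    subst (λ p → Near 0 (cycᵢ i (suc p))) (sym e) (cyc-Near D (suc (s i)) (s≤s z≤n))
  d₁-Near {inner i x} {c₂} e =
    subst (Near (d₁ (inner i x))) (trans (cong (cycᵢ i ∘ suc) e) (cyc-end (D≤1+s i)))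
          (cyc-Near D (suc (s i)) (s≤s (toℕ<n x)))
  d₁-Near {inner i x} {inner .i y} (refl , e) =
    subst (λ p → Near (d₁ (inner i x)) (cycᵢ i p)) (cong suc e) (cyc-Near D (suc (s i)) (s≤s (toℕ<n x)))

  Within : Fin m → ThetaV m s → Set
  Within i y = ∀ {i′} → OnPath i′ y → i′ ≡ i

  step-toward-c₁ : ∀ i (x : Fin (s i)) →
                   Σ (ThetaV m s) λ y → Adj G (inner i x) y × Within i y × d₁ y ≡ cycᵢ i (toℕ x)
  step-toward-c₁ i x with toℕ x in e
  ... | zero = c₁ , inj₂ e , (λ ()) , refl
  ... | suc J with index-below x (subst (0 <_) (sym e) (s≤s z≤n))
  ...   | y , ey = inner i y , inj₂ (refl , ey) , sym , cong (cycᵢ i) (trans ey e)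

  step-toward-c₂ : ∀ i (x : Fin (s i)) →
                   Σ (ThetaV m s) λ y → Adj G (inner i x) y × Within i y × d₁ y ≡ cycᵢ i (suc (suc (toℕ x)))
  step-toward-c₂ i x with m≤n⇒m<n∨m≡n (toℕ<n x)
  ... | inj₁ sx<s with index-above x sx<s
  ...   | y , ey = inner i y , inj₁ (refl , sym ey) , sym , cong (cycᵢ i ∘ suc) ey
  step-toward-c₂ i x | inj₂ sx≡s =
    c₂ , inj₁ sx≡s , (λ ()) , sym (trans (cong (cycᵢ i ∘ suc) sx≡s) (cyc-end (D≤1+s i)))

  d₁-descent : ∀ i (x : Fin (s i)) {n} → d₁ (inner i x) ≡ suc n →
               Σ (ThetaV m s) λ y → Adj G (inner i x) y × Within i y × d₁ y ≡ n
  d₁-descent i x e with cyc-descent D (suc (s i)) (s≤s (toℕ<n x)) e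
  ... | inj₁ e′ with step-toward-c₁ i x
  ...   | y , a , within , e″ = y , a , within , trans e″ e′
  d₁-descent i x e | inj₂ e′ with step-toward-c₂ i x
  ...   | y , a , within , e″ = y , a , within , trans e″ e′

  c₂-descent : Σ (ThetaV m s) λ y → Adj G c₂ y × OnPath ι y × d₁ y ≡ s ι
  c₂-descent with last-index ι-nonempty
  ... | x , e = inner ι x , inj₂ e , refl ,
                trans (cong (cycᵢ ι) e) (cyc-short (n<1+n (s ι)) (m≤n⇒m≤1+n (n≤1+n (s ι))))

  -- A landmark at index k of path j, `far` steps before the last inner vertex of the path.
  -- via-c₁: reaching c₂ through c₁ is no longer than along path j, so every vertex off path j
  -- reaches the landmark fastest through c₁; not-too-far: vertices of path j are strictly closer.
  record Balanced (j : Fin m) (k : Fin (s j)) : Set where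
    field
      far         : ℕ
      length≡     : s j ≡ suc (toℕ k + far)
      via-c₁      : D + toℕ k ≤ far
      not-too-far : far ≤ suc (D + toℕ k)

  -- abstract: unfolding the ring-solver proof inside makes later with-abstractions intractable
  abstract
    balanced : ∀ j → D < s j → Σ (Fin (s j)) (Balanced j)
    balanced j D<s with halve (s j ∸ suc D)
    ... | K , e , e≤1 , t≡ = k , record
      { far         = D + K + e
      ; length≡     = trans s≡ (cong (λ z → suc (z + (D + K + e))) (sym K≡))
      ; via-c₁      = subst (λ z → D + z ≤ D + K + e) (sym K≡) (m≤m+n (D + K) e)
      ; not-too-far = subst (λ z → D + K + e ≤ suc (D + z)) (sym K≡)
                        (≤-trans (+-monoʳ-≤ (D + K) e≤1) (≤-reflexive (+-comm (D + K) 1)))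
      }
      where
      s≡ : s j ≡ suc (K + (D + K + e))
      s≡ = begin
        s j                          ≡⟨ sym (m+[n∸m]≡n D<s) ⟩
        suc (D + (s j ∸ suc D))      ≡⟨ cong (λ t → suc (D + t)) t≡ ⟩
        suc (D + (K + K + e))        ≡⟨ cong suc (rearrange D K e) ⟩
        suc (K + (D + K + e))        ∎
        where
        open ≡-Reasoning
        rearrange : ∀ D K e → D + (K + K + e) ≡ K + (D + K + e)
        rearrange = solve-∀
      K<s : K < s j
      K<s = subst (K <_) (sym s≡) (s≤s (m≤m+n K _))
      k : Fin (s j)
      k = fromℕ< K<s
      K≡ : toℕ k ≡ K
      K≡ = toℕ-fromℕ< K<s

  s-pos : ∀ i → 0 < s i
  s-pos i = ≤-trans ι-nonempty (ι-shortest i)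

  first : ∀ i → Fin (s i)
  first i = fromℕ< (s-pos i)

  first≡0 : ∀ i → toℕ (first i) ≡ 0
  first≡0 i = toℕ-fromℕ< (s-pos i)

  module Landmark (j : Fin m) (k : Fin (s j)) (b : Balanced j k) where
    open Balanced b

    K : ℕ
    K = toℕ k

    -- the distance to the landmark: along path j on it, through c₁ elsewhere
    ρ : ThetaV m s → ℕ
    ρ c₁ = suc K + d₁ c₁
    ρ c₂ = suc K + d₁ c₂
    ρ (inner i x) with i F.≟ j
    ... | yes _ = ∣ toℕ x - K ∣
    ... | no _ = suc K + d₁ (inner i x)

    ρ-on : ∀ x → ρ (inner j x) ≡ ∣ toℕ x - K ∣
    ρ-on x with j F.≟ j
    ... | yes _ = refl
    ... | no j≢j = ⊥-elim (j≢j refl)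

    ρ-off : ∀ y → ¬ OnPath j y → ρ y ≡ suc K + d₁ y
    ρ-off c₁ _ = refl
    ρ-off c₂ _ = refl
    ρ-off (inner i x) i≢j with i F.≟ j
    ... | yes i≡j = ⊥-elim (i≢j i≡j)
    ... | no _ = refl

    far-end : ∀ (x : Fin (s j)) → suc (toℕ x) ≡ s j → ∣ toℕ x - K ∣ ≡ far
    far-end x e = begin
      ∣ toℕ x - K ∣           ≡⟨ cong (∣_- K ∣) (suc-injective (trans e length≡)) ⟩
      ∣ K + far - K ∣         ≡⟨ ∣-∣-comm (K + far) K ⟩
      ∣ K - K + far ∣         ≡⟨ ∣m-m+n∣≡n K far ⟩
      far                     ∎
      where open ≡-Reasoning

    far-Near-c₂ : Near far (suc K + D)
    far-Near-c₂ = ≤-trans not-too-far (s≤s (≤-trans (≤-reflexive (+-comm D K)) (n≤1+n (K + D)))) ,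
                  s≤s (≤-trans (≤-reflexive (+-comm K D)) via-c₁)

    ρ-Near : ∀ {x y} → ThetaArc m s x y → Near (ρ x) (ρ y)
    ρ-Near {c₁} {inner i x} e with i F.≟ j
    ... | yes refl rewrite e | +-identityʳ K = ≤-refl , m≤n⇒m≤1+n (n≤1+n K)
    ... | no _ = +-Near (suc K) (d₁-Near {c₁} {inner i x} e)
    ρ-Near {inner i x} {c₂} e with i F.≟ j
    ... | yes refl = subst (λ r → Near r (suc K + D)) (sym (far-end x e)) far-Near-c₂
    ... | no _ = +-Near (suc K) (d₁-Near {inner i x} {c₂} e)
    ρ-Near {inner i x} {inner .i y} (refl , e) with i F.≟ j
    ... | yes refl = subst (λ z → Near ∣ toℕ x - K ∣ ∣ z - K ∣) e (∣-∣-Near (toℕ x) K)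
    ... | no _ = +-Near (suc K) (d₁-Near (refl , e))

    ρ≡0⇒landmark : ∀ y → ρ y ≡ 0 → y ≡ inner j k
    ρ≡0⇒landmark (inner i x) e with i F.≟ j
    ... | yes refl = cong (inner j) (toℕ-injective (∣m-n∣≡0⇒m≡n e))

    ρ-descent : ∀ y n → ρ y ≡ suc n → Σ (ThetaV m s) λ y′ → Adj G y y′ × ρ y′ ≡ n
    ρ-descent c₁ n e =
      inner j (first j) , inj₁ (first≡0 j) ,
      trans (ρ-on (first j)) (trans (cong (∣_- K ∣) (first≡0 j)) (trans (sym (+-identityʳ K)) (suc-injective e)))
    ρ-descent c₂ n e with c₂-descent
    ... | y′ , a , on-ι , d₁y′≡ =
      y′ , a , trans (ρ-off y′ (λ on-j → ι≢j (OnPath-unique y′ on-ι on-j)))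
                     (trans (cong (suc K +_) d₁y′≡) (suc-injective (trans (sym (+-suc (suc K) (s ι))) e)))
      where
      ι≢j : ι ≢ j
      ι≢j ι≡j = <-irrefl (cong s ι≡j)
        (≤-trans (m≤m+n D K) (≤-trans via-c₁ (≤-trans (m≤n+m far K) (≤-trans (n≤1+n _) (≤-reflexive (sym length≡))))))
    ρ-descent (inner i x) n e with i F.≟ j
    ρ-descent (inner i x) n e | no i≢j with d₁-descent i x refl
    ... | y′ , a , within , d₁y′≡ =
      y′ , a , trans (ρ-off y′ (λ on-j → i≢j (sym (within on-j))))
                     (trans (cong (suc K +_) d₁y′≡) (suc-injective (trans (sym (+-suc (suc K) _)) e)))
    ρ-descent (inner i x) n e | yes refl with <-cmp (toℕ x) K
    ... | tri< x<K _ _ with index-above x (≤-trans (s≤s x<K) (toℕ<n k))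
    ...   | y , ey = inner j y , inj₁ (refl , sym ey) ,
                     trans (ρ-on y) (trans (cong (∣_- K ∣) ey) (∣-∣-toward-up (toℕ x) K x<K e))
    ρ-descent (inner i x) n e | yes refl | tri≈ _ x≡K _ =
      ⊥-elim (0≢1+n (trans (sym (m≡n⇒∣m-n∣≡0 x≡K)) e))
    ρ-descent (inner i x) n e | yes refl | tri> _ _ K<x with index-below x (≤-trans (s≤s z≤n) K<x)
    ...   | y , ey = inner j y , inj₂ (refl , ey) ,
                     trans (ρ-on y) (∣-∣-toward-down (toℕ y) K (≤-pred (subst (K <_) (sym ey) K<x))
                                      (trans (cong (∣_- K ∣) ey) e))

    ρ-Dist : ∀ y → Dist G y (inner j k) (ρ y)
    ρ-Dist = potential⇒Dist (inner j k) ρ lip (trans (ρ-on k) (∣n-n∣≡0 K)) ρ≡0⇒landmark ρ-descent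
      where
      lip : ∀ {x y} → Adj G x y → ρ x ≤ suc (ρ y)
      lip (inj₁ a) = proj₁ (ρ-Near a)
      lip (inj₂ a) = proj₂ (ρ-Near a)

    ρ-on-< : ∀ x → ρ (inner j x) < suc K + d₁ (inner j x)
    ρ-on-< x = subst₂ _<_ (sym (ρ-on x)) (sym (+-distribˡ-⊓ (suc K) (suc X) _))
                 (⊓-glb toward-c₁ toward-c₂)
      where
      X = toℕ x

      toward-c₁ : ∣ X - K ∣ < suc K + suc X
      toward-c₁ = s≤s (≤-trans (∣m-n∣≤m⊔n X K) (≤-trans (m⊔n≤m+n X K)
                   (≤-trans (≤-reflexive (+-comm X K)) (+-monoʳ-≤ K (n≤1+n X)))))

      toward-c₂ : ∣ X - K ∣ < suc K + (D + (s j ∸ X))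
      toward-c₂ with ≤-total X K
      ... | inj₁ X≤K = s≤s (≤-trans (≤-reflexive (m≤n⇒∣m-n∣≡n∸m X≤K)) (≤-trans (m∸n≤m K X) (m≤m+n K _)))
      ... | inj₂ K≤X = s≤s (begin
        ∣ X - K ∣             ≡⟨ m≤n⇒∣n-m∣≡n∸m K≤X ⟩
        X ∸ K                 ≤⟨ ∸-monoˡ-≤ K X≤K+far ⟩
        K + far ∸ K           ≡⟨ m+n∸m≡n K far ⟩
        far                   ≤⟨ not-too-far ⟩
        suc (D + K)           ≡⟨ cong suc (+-comm D K) ⟩
        suc (K + D)           ≡⟨ sym (+-suc K D) ⟩
        K + suc D             ≡⟨ cong (K +_) (+-comm 1 D) ⟩
        K + (D + 1)           ≤⟨ +-monoʳ-≤ K (+-monoʳ-≤ D (m<n⇒0<n∸m (toℕ<n x))) ⟩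
        K + (D + (s j ∸ X))   ∎)
        where
        open ≤-Reasoning
        X≤K+far : X ≤ K + far
        X≤K+far = ≤-pred (subst (X <_) length≡ (toℕ<n x))

    ρ-Dist-mirrored : ∀ b y → Dist G y (mirror b (inner j k)) (ρ (mirror b y))
    ρ-Dist-mirrored b y =
      subst (λ z → Dist G z (mirror b (inner j k)) (ρ (mirror b y))) (mirror-involutive b y)
        (Dist-involution (mirror b) (mirror-Adj b) (mirror-involutive b) (ρ-Dist (mirror b y)))

  walk-to-c₂ : ∀ i (x : Fin (s i)) {n} → s i ∸ toℕ x ≡ n → Walk G (inner i x) c₂ n
  walk-to-c₂ i x {zero} e = ⊥-elim (<-irrefl (sym e) (m<n⇒0<n∸m (toℕ<n x)))
  walk-to-c₂ i x {suc n} e with m≤n⇒m<n∨m≡n (toℕ<n x)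
  ... | inj₁ sx<s with index-above x sx<s
  ...   | y , ey = step (inj₁ (refl , sym ey)) (walk-to-c₂ i y (suc-injective (begin
          suc (s i ∸ toℕ y)       ≡⟨ cong (λ z → suc (s i ∸ z)) ey ⟩
          suc (s i ∸ suc (toℕ x)) ≡⟨ sym (m<n⇒n∸m≡1+[n∸1+m] (toℕ<n x)) ⟩
          s i ∸ toℕ x             ≡⟨ e ⟩
          suc n                   ∎)))
    where open ≡-Reasoning
  walk-to-c₂ i x {suc n} e | inj₂ sx≡s =
    subst (λ l → Walk G (inner i x) c₂ (suc l)) n≡0 (step (inj₁ sx≡s) here)
    where
    n≡0 : 0 ≡ n
    n≡0 = suc-injective (trans (sym (trans (cong (_∸ toℕ x) (sym sx≡s)) (m+n∸n≡m 1 (toℕ x)))) e)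

  c₁-c₂-walk : Walk G c₁ c₂ D
  c₁-c₂-walk = step (inj₁ (first≡0 ι)) (walk-to-c₂ ι (first ι) (cong (s ι ∸_) (first≡0 ι)))

  leave-path : ∀ {i} {x : Fin (s i)} {w k} → ¬ OnPath i w → Walk G (inner i x) w k →
               (Σ ℕ λ k₁ → Walk G c₁ w k₁ × suc (toℕ x) + k₁ ≤ k) ⊎
               (Σ ℕ λ k₂ → Walk G c₂ w k₂ × (s i ∸ toℕ x) + k₂ ≤ k)
  leave-path w∉ here = ⊥-elim (w∉ refl)
  leave-path w∉ (step {w = c₁} (inj₂ x≡0) p) =
    inj₁ (_ , p , ≤-reflexive (cong (λ z → suc z + _) x≡0))
  leave-path {i} {x} {k = suc k} w∉ (step {w = c₂} (inj₁ sx≡s) p) =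
    inj₂ (k , p , ≤-reflexive (cong (_+ k) (trans (cong (_∸ toℕ x) (sym sx≡s)) (m+n∸n≡m 1 (toℕ x)))))
  leave-path {i} {x} w∉ (step {w = inner .i y} (inj₁ (refl , sx≡y)) p) with leave-path w∉ p
  ... | inj₁ (k₁ , q , le) =
    inj₁ (k₁ , q , ≤-trans (≤-reflexive (cong (_+ k₁) sx≡y)) (≤-trans (n≤1+n _) (≤-trans le (n≤1+n _))))
  ... | inj₂ (k₂ , q , le) =
    inj₂ (k₂ , q , ≤-trans (≤-reflexive (cong (_+ k₂) s∸x≡)) (s≤s le))
    where
    s∸x≡ : s i ∸ toℕ x ≡ suc (s i ∸ toℕ y)
    s∸x≡ = trans (m<n⇒n∸m≡1+[n∸1+m] (toℕ<n x)) (cong (λ z → suc (s i ∸ z)) sx≡y)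
  leave-path {i} {x} w∉ (step {w = inner .i y} (inj₂ (refl , sy≡x)) p) with leave-path w∉ p
  ... | inj₁ (k₁ , q , le) =
    inj₁ (k₁ , q , ≤-trans (≤-reflexive (cong (λ z → suc z + k₁) (sym sy≡x))) (s≤s le))
  ... | inj₂ (k₂ , q , le) =
    inj₂ (k₂ , q , ≤-trans (n≤1+n _) (≤-trans (≤-reflexive (cong (_+ k₂) s∸x≡)) (≤-trans le (n≤1+n _))))
    where
    s∸x≡ : suc (s i ∸ toℕ x) ≡ s i ∸ toℕ y
    s∸x≡ = trans (cong (λ z → suc (s i ∸ z)) (sym sy≡x)) (sym (m<n⇒n∸m≡1+[n∸1+m] (toℕ<n y)))

  entry : Fin m → ThetaV m s
  entry i = inner i (first i)

  -- A walk out of path i leaves through c₁ or c₂; since path i is longer than the detour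
  -- c₁ → c₂ along path ι, leaving through c₁ is never worse, and every entry vertex is adjacent to c₁.
  entry-closer : ∀ {i i′ w du dv} → D < s i → ¬ OnPath i w →
                 Dist G (entry i) w du → Dist G (entry i′) w dv → dv ≤ du
  entry-closer {i} {i′} D<s w∉ (p , _) (_ , shortest) with leave-path w∉ p
  ... | inj₁ (k₁ , q , le) =
    ≤-trans (shortest _ (step (inj₂ (first≡0 i′)) q))
            (≤-trans (≤-reflexive (cong (λ z → suc z + k₁) (sym (first≡0 i)))) le)
  ... | inj₂ (k₂ , q , le) =
    ≤-trans (shortest _ (step (inj₂ (first≡0 i′)) (c₁-c₂-walk ++ʷ q)))
            (≤-trans (+-monoˡ-≤ k₂ D<s)
                     (≤-trans (≤-reflexive (cong (λ z → (s i ∸ z) + k₂) (sym (first≡0 i)))) le))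

  d₂-inner : ∀ i (x : Fin (s i)) → d₂ (inner i x) ≡ cycᵢ i (s i ∸ toℕ x)
  d₂-inner i x = cong (cycᵢ i) (trans (cong suc (FP.opposite-prop x)) (sym (m<n⇒n∸m≡1+[n∸1+m] (toℕ<n x))))

  profile-injective : ∀ i (x y : Fin (s i)) →
                      d₁ (inner i x) ≡ d₁ (inner i y) → d₂ (inner i x) ≡ d₂ (inner i y) → x ≡ y
  profile-injective i x y e₁ e₂ =
    toℕ-injective (suc-injective (⊓-pair-injective (s≤s z≤n) (trans (sum x) (sym (sum y))) e₁
                                                   (trans (sym (d₂-⊓ x)) (trans e₂ (d₂-⊓ y)))))
    where
    sum : ∀ (x : Fin (s i)) → suc (toℕ x) + (s i ∸ toℕ x) ≡ suc (s i)
    sum x = cong suc (m+[n∸m]≡n (<⇒≤ (toℕ<n x)))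
    d₂-⊓ : ∀ (x : Fin (s i)) → d₂ (inner i x) ≡ (s i ∸ toℕ x) ⊓ (D + suc (toℕ x))
    d₂-⊓ x = trans (d₂-inner i x)
                   (cong (λ z → (s i ∸ toℕ x) ⊓ (D + z)) (m∸[m∸n]≡n (s≤s (<⇒≤ (toℕ<n x)))))

  short-path-sum : ∀ i (x : Fin (s i)) → s i ≤ suc D → d₁ (inner i x) + d₂ (inner i x) ≡ suc (s i)
  short-path-sum i x short = begin
    d₁ (inner i x) + d₂ (inner i x)  ≡⟨ cong₂ _+_ (cyc-short (s≤s (toℕ<n x)) (≤-trans (toℕ<n x) short))
                                                  (trans (d₂-inner i x) (cyc-short (s≤s s∸x≤s) (≤-trans s∸x≤s short))) ⟩
    suc (toℕ x) + (s i ∸ toℕ x)      ≡⟨ cong suc (m+[n∸m]≡n (<⇒≤ (toℕ<n x))) ⟩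
    suc (s i)                        ∎
    where
    open ≡-Reasoning
    s∸x≤s : s i ∸ toℕ x ≤ s i
    s∸x≤s = m∸n≤m (s i) (toℕ x)

  d₁≡0⇒c₁ : ∀ x → d₁ x ≡ 0 → x ≡ c₁
  d₁≡0⇒c₁ c₁ _ = refl

  d₂≡0⇒c₂ : ∀ x → d₂ x ≡ 0 → x ≡ c₂
  d₂≡0⇒c₂ x e = trans (sym (σ-involutive x)) (cong σ (d₁≡0⇒c₁ (σ x) e))

  resolving-meets-long-paths : ∀ {k} (p : Fin (suc k) → Fin m) → (∀ {c c′} → p c ≡ p c′ → c ≡ c′) →
                               (∀ c → D < s (p c)) → ∀ W → Resolving G W → k ≤ length W
  resolving-meets-long-paths p p-injective long =
    twins⇒≤length (OnPath ∘ p) (OnPath? ∘ p) (λ x on on′ → p-injective (OnPath-unique x on on′))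
                  (entry ∘ p) (λ _ → refl)
                  (λ {c} {c′} w∉ w∉′ Du Dv → ≤-antisym (entry-closer (long c′) w∉′ Dv Du)
                                                       (entry-closer (long c) w∉ Du Dv))

lengths-from-first : ∀ {m} (s : Fin (suc m) → ℕ) →
                     (∀ i j → toℕ j ≡ suc (toℕ i) → s j ≡ suc (s i)) → ∀ i → s i ≡ s F.zero + toℕ i
lengths-from-first {m} s succ i = from (toℕ i) i refl
  where
  from : ∀ t i → toℕ i ≡ t → s i ≡ s F.zero + t
  from zero i e = trans (cong s (toℕ-injective e)) (sym (+-identityʳ _))
  from (suc t) i e = begin
    s i                 ≡⟨ succ i′ i (trans e (cong suc (sym (toℕ-fromℕ< t<)))) ⟩
    suc (s i′)          ≡⟨ cong suc (from t i′ (toℕ-fromℕ< t<)) ⟩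
    suc (s F.zero + t)  ≡⟨ sym (+-suc (s F.zero) t) ⟩
    s F.zero + suc t    ∎
    where
    open ≡-Reasoning
    t< : t < suc m
    t< = ≤-trans (n≤1+n (suc t)) (subst (_< suc m) e (toℕ<n i))
    i′ = fromℕ< t<

module Consecutive (n : ℕ) (s : Fin (7 + n) → ℕ) (s-pos : ∀ i → 1 ≤ s i)
                   (consecutive : ∀ i → s i ≡ s F.zero + toℕ i) where

  a : ℕ
  a = s F.zero

  open ThetaGeometry (7 + n) s F.zero (λ i → subst (a ≤_) (sym (consecutive i)) (m≤m+n a (toℕ i)))
                     (s-pos F.zero)

  long : ∀ i → 2 ≤ toℕ i → D < s i
  long i 2≤i = subst (D <_) (sym (consecutive i)) (≤-trans (≤-reflexive (+-comm 2 a)) (+-monoʳ-≤ a 2≤i))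

  short : ∀ i → toℕ i ≤ 2 → s i ≤ suc D
  short i i≤2 = subst (_≤ suc D) (sym (consecutive i)) (≤-trans (+-monoʳ-≤ a i≤2) (≤-reflexive (+-comm a 2)))

  s-injective : ∀ {i i′} → s i ≡ s i′ → i ≡ i′
  s-injective {i} {i′} e =
    toℕ-injective (+-cancelˡ-≡ a _ _ (trans (sym (consecutive i)) (trans e (consecutive i′))))

  path : Fin (4 + n) → Fin (7 + n)
  path c = F.suc (F.suc (F.suc c))

  path-injective : ∀ {c c′} → path c ≡ path c′ → c ≡ c′
  path-injective = FP.suc-injective ∘ FP.suc-injective ∘ FP.suc-injective

  spot : ∀ c → Σ (Fin (s (path c))) (Balanced (path c))
  spot c = balanced (path c) (long (path c) (s≤s (s≤s z≤n)))

  module L (c : Fin (4 + n)) = Landmark (path c) (proj₁ (spot c)) (proj₂ (spot c))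

  -- The landmarks on paths 3 and 4 are mirrored by σ. Off its path an unmirrored landmark reads
  -- d₁ and a mirrored one d₂, up to a shift; with two of each kind, every path avoids one of each.
  mirrored : Fin (4 + n) → Bool
  mirrored F.zero = true
  mirrored (F.suc F.zero) = true
  mirrored _ = false

  landmark : Fin (4 + n) → ThetaV (7 + n) s
  landmark c = mirror (mirrored c) (inner (path c) (proj₁ (spot c)))

  reading : Fin (4 + n) → ThetaV (7 + n) s → ℕ
  reading c x = L.ρ c (mirror (mirrored c) x)

  reading-Dist : ∀ c x → Dist G x (landmark c) (reading c x)
  reading-Dist c = L.ρ-Dist-mirrored c (mirrored c)

  δ : Bool → ThetaV (7 + n) s → ℕ
  δ b x = d₁ (mirror b x)

  reading-off : ∀ c x → ¬ OnPath (path c) x → reading c x ≡ suc (L.K c) + δ (mirrored c) x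
  reading-off c x x∉ = L.ρ-off c (mirror (mirrored c) x) (x∉ ∘ mirror-OnPath (mirrored c) x)

  reading-on : ∀ c x → OnPath (path c) x → reading c x < suc (L.K c) + δ (mirrored c) x
  reading-on c (inner _ y) refl with mirrored c
  ... | false = L.ρ-on-< c y
  ... | true = L.ρ-on-< c (F.opposite y)

  another : ∀ b c → Σ (Fin (4 + n)) λ c′ → c′ ≢ c × mirrored c′ ≡ b
  another true c with c F.≟ F.zero
  ... | yes refl = F.suc F.zero , (λ ()) , refl
  ... | no c≢0 = F.zero , c≢0 ∘ sym , refl
  another false c with c F.≟ F.suc (F.suc F.zero)
  ... | yes refl = F.suc (F.suc (F.suc F.zero)) , (λ ()) , refl
  ... | no c≢2 = F.suc (F.suc F.zero) , c≢2 ∘ sym , refl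

  off-other-path : ∀ {c c′ x} → c′ ≢ c → OnPath (path c) x → ¬ OnPath (path c′) x
  off-other-path {x = x} c′≢c on on′ = c′≢c (path-injective (OnPath-unique x on′ on))

  Agree : ThetaV (7 + n) s → ThetaV (7 + n) s → Set
  Agree u v = ∀ c → reading c u ≡ reading c v

  δ-agree : ∀ {u v b} → Agree u v → ∀ c → mirrored c ≡ b →
            ¬ OnPath (path c) u → ¬ OnPath (path c) v → δ b u ≡ δ b v
  δ-agree {u} {v} agree c refl u∉ v∉ =
    +-cancelˡ-≡ (suc (L.K c)) _ _ (trans (sym (reading-off c u u∉)) (trans (agree c) (reading-off c v v∉)))

  δ-drops : ∀ {u v b} → Agree u v → ∀ c → mirrored c ≡ b →
            OnPath (path c) u → ¬ OnPath (path c) v → δ b v < δ b u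
  δ-drops {u} {v} agree c refl u∈ v∉ =
    +-cancelˡ-< (suc (L.K c)) _ _ (subst (_< suc (L.K c) + δ (mirrored c) u) (trans (agree c) (reading-off c v v∉)) (reading-on c u u∈))

  -- If v were off path c, the landmark of the other path c′ of the same kind would give
  -- δ u = δ v when v is off path c′, and δ u < δ v when v is on it.
  agree-on-path : ∀ {u v} → Agree u v → ∀ c → OnPath (path c) u → OnPath (path c) v
  agree-on-path {u} {v} agree c u∈ with OnPath? (path c) v | another (mirrored c) c
  ... | yes v∈ | _ = v∈
  ... | no v∉ | c′ , c′≢c , same-kind with OnPath? (path c′) v
  ...   | yes v∈′ = ⊥-elim (<-asym (δ-drops agree c refl u∈ v∉)
                                   (δ-drops (sym ∘ agree) c′ same-kind v∈′ (off-other-path c′≢c u∈)))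
  ...   | no v∉′ = ⊥-elim (<-irrefl (sym (δ-agree agree c′ same-kind (off-other-path c′≢c u∈) v∉′))
                                    (δ-drops agree c refl u∈ v∉))

  Low : ThetaV (7 + n) s → Set
  Low x = ∀ c → ¬ OnPath (path c) x

  landmark-path-or-low : ∀ x → (Σ (Fin (4 + n)) λ c → OnPath (path c) x) ⊎ Low x
  landmark-path-or-low (inner (F.suc (F.suc (F.suc c))) _) = inj₁ (c , refl)
  landmark-path-or-low (inner F.zero _) = inj₂ λ _ ()
  landmark-path-or-low (inner (F.suc F.zero) _) = inj₂ λ _ ()
  landmark-path-or-low (inner (F.suc (F.suc F.zero)) _) = inj₂ λ _ ()
  landmark-path-or-low c₁ = inj₂ λ _ ()
  landmark-path-or-low c₂ = inj₂ λ _ ()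

  low-short : ∀ {i x} → Low (inner i x) → s i ≤ suc D
  low-short {F.zero} _ = short F.zero z≤n
  low-short {F.suc F.zero} _ = short (F.suc F.zero) (s≤s z≤n)
  low-short {F.suc (F.suc F.zero)} _ = short (F.suc (F.suc F.zero)) (s≤s (s≤s z≤n))
  low-short {F.suc (F.suc (F.suc c))} low = ⊥-elim (low c refl)

  low-same-path : ∀ {i i′ x y} → Low (inner i x) → Low (inner i′ y) →
                  d₁ (inner i x) ≡ d₁ (inner i′ y) → d₂ (inner i x) ≡ d₂ (inner i′ y) → i ≡ i′
  low-same-path {i} {i′} {x} {y} u-low v-low e₁ e₂ = s-injective (suc-injective (begin
    suc (s i)                          ≡⟨ sym (short-path-sum i x (low-short {i} {x} u-low)) ⟩
    d₁ (inner i x) + d₂ (inner i x)    ≡⟨ cong₂ _+_ e₁ e₂ ⟩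
    d₁ (inner i′ y) + d₂ (inner i′ y)  ≡⟨ short-path-sum i′ y (low-short {i′} {y} v-low) ⟩
    suc (s i′)                         ∎))
    where open ≡-Reasoning

  low-determined : ∀ u v → Low u → Low v → d₁ u ≡ d₁ v → d₂ u ≡ d₂ v → u ≡ v
  low-determined c₁ v _ _ e₁ _ = sym (d₁≡0⇒c₁ v (sym e₁))
  low-determined c₂ v _ _ _ e₂ = sym (d₂≡0⇒c₂ v (sym e₂))
  low-determined (inner i x) c₁ _ _ e₁ _ = d₁≡0⇒c₁ (inner i x) e₁
  low-determined (inner i x) c₂ _ _ _ e₂ = d₂≡0⇒c₂ (inner i x) e₂
  low-determined (inner i x) (inner i′ y) u-low v-low e₁ e₂ with low-same-path u-low v-low e₁ e₂
  ... | refl = cong (inner i) (profile-injective i x y e₁ e₂)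

  same-path : ∀ {u v} → Agree u v → ∀ c → OnPath (path c) u → OnPath (path c) v → u ≡ v
  same-path {inner _ x} {inner _ y} agree c refl refl =
    cong (inner (path c)) (profile-injective (path c) x y (off (another false c)) (off (another true c)))
    where
    off : ∀ {b} → (Σ (Fin (4 + n)) λ c′ → c′ ≢ c × mirrored c′ ≡ b) →
          δ b (inner (path c) x) ≡ δ b (inner (path c) y)
    off (c′ , c′≢c , kind) = δ-agree agree c′ kind (off-other-path {x = inner (path c) x} c′≢c refl)
                                                   (off-other-path {x = inner (path c) y} c′≢c refl)

  readings-determine : ∀ u v → Agree u v → u ≡ v
  readings-determine u v agree with landmark-path-or-low u
  ... | inj₁ (c , u∈) = same-path agree c u∈ (agree-on-path agree c u∈)
  ... | inj₂ u-low with landmark-path-or-low v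
  ...   | inj₁ (c , v∈) = ⊥-elim (u-low c (agree-on-path (sym ∘ agree) c v∈))
  ...   | inj₂ v-low = low-determined u v u-low v-low
                         (δ-agree agree (F.suc (F.suc F.zero)) refl (u-low _) (v-low _))
                         (δ-agree agree F.zero refl (u-low _) (v-low _))

  landmark-injective : ∀ {c c′} → landmark c ≡ landmark c′ → c ≡ c′
  landmark-injective {c} {c′} e = path-injective (OnPath-unique (landmark c′)
    (subst (OnPath (path c)) e (landmark-on-path c)) (landmark-on-path c′))
    where
    landmark-on-path : ∀ c → OnPath (path c) (landmark c)
    landmark-on-path c with mirrored c
    ... | false = refl
    ... | true = refl

  resolving-size : ∀ W → Resolving G W → 4 + n ≤ length W
  resolving-size = resolving-meets-long-paths (λ c → F.suc (F.suc c)) (FP.suc-injective ∘ FP.suc-injective)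
                                              (λ c → long (F.suc (F.suc c)) (s≤s (s≤s z≤n)))

mainTheorem13 : (m : ℕ) → 6 < m → (s : Fin m → ℕ) → (∀ i → 1 ≤ s i)
    → (∀ (i j : Fin m) → toℕ j ≡ suc (toℕ i) → s j ≡ suc (s i))
    → MetricDimension (Theta m s) (m ∸ 3)
mainTheorem13 _ (s≤s (s≤s (s≤s (s≤s (s≤s (s≤s (s≤s {n = n} z≤n))))))) s s-pos succ =
  (tabulate landmark , tabulate⁺ landmark-injective , length-tabulate landmark ,
   tabulate-Resolving landmark reading reading-Dist readings-determine) ,
  λ W _ → resolving-size W
  where open Consecutive n s s-pos (lengths-from-first s succ)
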